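{- Let $m \ge 3$ be an integer and let $G = P_3 \mathbin{\Box} P_m$. Then \[ m(G,3)= \begin{cases} \frac{3}{2}(m+1) - 1, & m \text{ odd},\\[2pt] \frac{3}{2}m + 1, & m \text{ even}. \end{cases} \]
   Context: For a graph $G$ and an integer $r \ge 2$, the $r$-neighbor bootstrap percolation process starting from a set $A_0 \subseteq V(G)$ of initially infected vertices is defined by $A_t = A_{t-1} \cup \{ v \in V(G) : |N_G(v) \cap A_{t-1}| \ge r\}$ for $t \ge 1$. The set $A_0$ is $r$-percolating if $\bigcup_{t \ge 0} A_t = V(G)$. The $r$-percolation number $m(G,r)$ is the minimum cardinality of an $r$-percolating set of $G$. $P_n$ denotes the path on $n$ vertices and $\mathbin{\Box}$ denotes the Cartesian product of graphs, so $P_n \mathbin{\Box} P_m$ is the $n \times m$ grid graph. -}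

module Defs where

open import Data.Nat using (ℕ; zero; suc; _+_; _*_; _≤_; _≤ᵇ_)
open import Data.Bool using (Bool; true; false; _∧_; _∨_; if_then_else_)
open import Data.Fin using (Fin; toℕ; remQuot)
open import Data.Fin.Subset using (Subset; _∈_; ∣_∣; inside; outside)
open import Data.Vec using (Vec; tabulate; lookup; countᵇ; allFin)
open import Data.Product using (_×_; _,_; ∃-syntax)
open import Relation.Binary.PropositionalEquality using (_≡_)

record Graph : Set where
  field
    order : ℕ
    adj   : Fin order → Fin order → Bool
    adj-sym   : ∀ u v → adj u v ≡ adj v u
    adj-irrefl : ∀ v → adj v v ≡ false
open Graph public

_∈ᵇ_ : ∀ {n} → Fin n → Subset n → Bool
v ∈ᵇ A = lookup A v

nbrCount : (G : Graph) → Subset (order G) → Fin (order G) → ℕ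
nbrCount G A v = countᵇ (λ u → adj G v u ∧ (u ∈ᵇ A)) (allFin (order G))

step : (G : Graph) → ℕ → Subset (order G) → Subset (order G)
step G r A = tabulate (λ v → (v ∈ᵇ A) ∨ (r ≤ᵇ nbrCount G A v))

infected : (G : Graph) → ℕ → Subset (order G) → ℕ → Subset (order G)
infected G r A₀ zero    = A₀
infected G r A₀ (suc t) = step G r (infected G r A₀ t)

Percolating : (G : Graph) → ℕ → Subset (order G) → Set
Percolating G r A₀ = ∀ v → ∃[ t ] (v ∈ infected G r A₀ t)

IsPercolationNumber : (G : Graph) → ℕ → ℕ → Set
IsPercolationNumber G r k =
  (∃[ A ] (Percolating G r A × ∣ A ∣ ≡ k)) ×
  (∀ A → Percolating G r A → k ≤ ∣ A ∣)

pathAdj : ∀ {n} → Fin n → Fin n → Bool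
pathAdj i j = (suc (toℕ i) Data.Nat.≡ᵇ toℕ j) ∨ (suc (toℕ j) Data.Nat.≡ᵇ toℕ i)

prodAdj : ∀ {a b} → Fin a × Fin b → Fin a × Fin b → Bool
prodAdj (i , j) (i' , j') =
  ((toℕ i Data.Nat.≡ᵇ toℕ i') ∧ pathAdj j j') ∨
  ((toℕ j Data.Nat.≡ᵇ toℕ j') ∧ pathAdj i i')

gridAdj : (a b : ℕ) → Fin (a * b) → Fin (a * b) → Bool
gridAdj a b x y = prodAdj (remQuot {a} b x) (remQuot {a} b y)

private
  open import Data.Bool.Properties using (∨-comm)
  open import Relation.Binary.PropositionalEquality using (refl; cong₂)

  ≡ᵇ-sym : ∀ m n → (m Data.Nat.≡ᵇ n) ≡ (n Data.Nat.≡ᵇ m)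
  ≡ᵇ-sym zero zero = refl
  ≡ᵇ-sym zero (suc n) = refl
  ≡ᵇ-sym (suc m) zero = refl
  ≡ᵇ-sym (suc m) (suc n) = ≡ᵇ-sym m n

  ≡ᵇ-refl : ∀ m → (m Data.Nat.≡ᵇ m) ≡ true
  ≡ᵇ-refl zero = refl
  ≡ᵇ-refl (suc m) = ≡ᵇ-refl m

  suc≢ : ∀ m → (suc m Data.Nat.≡ᵇ m) ≡ false
  suc≢ zero = refl
  suc≢ (suc m) = suc≢ m

  pathAdj-sym : ∀ {n} (i j : Fin n) → pathAdj i j ≡ pathAdj j i
  pathAdj-sym i j = ∨-comm (suc (toℕ i) Data.Nat.≡ᵇ toℕ j) _

  pathAdj-irr : ∀ {n} (i : Fin n) → pathAdj i i ≡ false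
  pathAdj-irr i rewrite suc≢ (toℕ i) = refl

  gridAdj-sym : ∀ a b x y → gridAdj a b x y ≡ gridAdj a b y x
  prod-sym : ∀ {a b} (p q : Fin a × Fin b) → prodAdj p q ≡ prodAdj q p
  prod-sym (i , j) (i' , j') =
    cong₂ _∨_ (cong₂ _∧_ (≡ᵇ-sym (toℕ i) (toℕ i')) (pathAdj-sym j j'))
              (cong₂ _∧_ (≡ᵇ-sym (toℕ j) (toℕ j')) (pathAdj-sym i i'))

  gridAdj-sym a b x y = prod-sym (remQuot {a} b x) (remQuot {a} b y)

  prod-irr : ∀ {a b} (p : Fin a × Fin b) → prodAdj p p ≡ false
  prod-irr (i , j) rewrite ≡ᵇ-refl (toℕ i) | ≡ᵇ-refl (toℕ j)
                      | pathAdj-irr i | pathAdj-irr j = refl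
  gridAdj-irr : ∀ a b x → gridAdj a b x x ≡ false
  gridAdj-irr a b x = prod-irr (remQuot {a} b x)

Grid : ℕ → ℕ → Graph
Grid a b = record
  { order = a * b
  ; adj = gridAdj a b
  ; adj-sym = gridAdj-sym a b
  ; adj-irrefl = gridAdj-irr a b
  }

-- A set S of cells is resistant if every cell of S has at most two grid neighbours outside S.
-- The complement of a resistant set is closed under 3-neighbour infection, so a percolating set
-- meets every resistant set. Corner cells, two adjacent cells of an outer row, a full column and
-- the two zigzags through two adjacent columns are resistant, so a percolating set has two cells
-- in each end column and three in any two adjacent columns; pairing the columns from the left
-- gives the lower bound. Conversely, take the even columns and the last column of the outer rows
-- and the odd columns but the last of the middle row: one step infects every cell except the
-- middle cell of the last column, and the second step infects that one.

module Submission where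

open import Algebra.Properties.CommutativeSemigroup using (interchange)
open import Data.Bool using (Bool; true; false; _∧_; _∨_; not; if_then_else_; T)
open import Data.Bool.ListAction using (any)
open import Data.Bool.Properties using (∨-zeroʳ; not-involutive; T-≡; T-∧; T-∨)
open import Data.Empty using (⊥-elim)
open import Data.Fin using (Fin; toℕ; fromℕ<; remQuot; combine) renaming (zero to fzero; suc to fsuc)
open import Data.Fin.Properties
  using (toℕ-injective; toℕ-fromℕ<; toℕ<n; remQuot-combine; combine-remQuot; toℕ-combine)
  renaming (suc-injective to fsuc-injective)
open import Data.Fin.Subset using (Subset; ∣_∣; _∈_; _∉_; _⊆_; _-_)
open import Data.Fin.Subset.Properties using (_∈?_; x∈p⇒∣p-x∣<∣p∣; x∈p∧x≢y⇒x∈p-y)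
open import Data.List using (List; []; _∷_)
open import Data.List.Relation.Unary.Any using (here; there)
open import Data.List.Relation.Unary.Any.Properties using (any⁺)
open import Data.Nat using (ℕ; zero; suc; pred; _+_; _*_; _∸_; _≤_; _<_; _≡ᵇ_; _≤ᵇ_; z≤n; s≤s)
open import Data.Nat.DivMod using (_/_; _%_; m*n/n≡m; [m+kn]%n≡m%n)
open import Data.Nat.Properties
open import Data.Nat.Tactic.RingSolver using (solve-∀)
open import Data.Product using (_×_; _,_; proj₁; proj₂; ∃-syntax; uncurry)
open import Data.Product.Properties using (≡-dec)
open import Data.Sum using (_⊎_; inj₁; inj₂)
open import Data.Vec using (Vec; []; _∷_; tabulate; lookup; countᵇ; allFin)
open import Data.Vec.Properties using (lookup∘tabulate; lookup⇒[]=; []=⇒lookup)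
open import Function using (id; _∘_; Equivalence)
open import Relation.Binary.PropositionalEquality
open import Relation.Nullary using (¬_; Dec; yes; no; does)
open import Relation.Nullary.Decidable using (dec-true; dec-false)

open import Defs

true≢false : true ≢ false
true≢false ()

≡ᵇ-refl : ∀ k → (k ≡ᵇ k) ≡ true
≡ᵇ-refl k = Equivalence.to T-≡ (≡⇒≡ᵇ k k refl)

≤ᵇ-true : ∀ {a b} → a ≤ b → (a ≤ᵇ b) ≡ true
≤ᵇ-true a≤b = Equivalence.to T-≡ (≤⇒≤ᵇ a≤b)

≤ᵇ-false : ∀ {a b} → b < a → (a ≤ᵇ b) ≡ false
≤ᵇ-false {a} {b} b<a with a ≤ᵇ b in a≤ᵇb
... | true  = ⊥-elim (<⇒≱ b<a (≤ᵇ⇒≤ a b (Equivalence.from T-≡ a≤ᵇb)))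
... | false = refl

⟦_⟧ : Bool → ℕ
⟦ true  ⟧ = 1
⟦ false ⟧ = 0

isEven : ℕ → Bool
isEven zero    = true
isEven (suc k) = not (isEven k)

∀ᵇ : ∀ n → (Vec Bool n → Bool) → Bool
∀ᵇ zero    f = f []
∀ᵇ (suc n) f = ∀ᵇ n (f ∘ (false ∷_)) ∧ ∀ᵇ n (f ∘ (true ∷_))

∀ᵇ-sound : ∀ n f → T (∀ᵇ n f) → ∀ bs → T (f bs)
∀ᵇ-sound zero    f all []           = all
∀ᵇ-sound (suc n) f all (false ∷ bs) = ∀ᵇ-sound n _ (proj₁ (Equivalence.to T-∧ all)) bs
∀ᵇ-sound (suc n) f all (true  ∷ bs) = ∀ᵇ-sound n _ (proj₂ (Equivalence.to T-∧ all)) bs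

private variable
  A : Set
  n : ℕ

countᵇ-mono : (P Q : A → Bool) (xs : Vec A n) → (∀ x → P x ≡ true → Q x ≡ true) →
  countᵇ P xs ≤ countᵇ Q xs
countᵇ-mono P Q [] P⇒Q = z≤n
countᵇ-mono P Q (x ∷ xs) P⇒Q with P x in Px | Q x in Qx
... | true  | true  = s≤s (countᵇ-mono P Q xs P⇒Q)
... | true  | false with () ← trans (sym (P⇒Q x Px)) Qx
... | false | true  = m≤n⇒m≤1+n (countᵇ-mono P Q xs P⇒Q)
... | false | false = countᵇ-mono P Q xs P⇒Q

countᵇ-∨ : (P Q : A → Bool) (xs : Vec A n) → countᵇ (λ x → P x ∨ Q x) xs ≤ countᵇ P xs + countᵇ Q xs
countᵇ-∨ P Q [] = z≤n
countᵇ-∨ P Q (x ∷ xs) with P x | Q x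
... | true  | true  = s≤s (≤-trans (countᵇ-∨ P Q xs) (+-monoʳ-≤ (countᵇ P xs) (n≤1+n _)))
... | true  | false = s≤s (countᵇ-∨ P Q xs)
... | false | true  = ≤-trans (s≤s (countᵇ-∨ P Q xs)) (≤-reflexive (sym (+-suc _ _)))
... | false | false = countᵇ-∨ P Q xs

countᵇ-tabulate : (P : A → Bool) (f : Fin n → A) → countᵇ P (tabulate f) ≡ ∣ tabulate (P ∘ f) ∣
countᵇ-tabulate {n = zero}  P f = refl
countᵇ-tabulate {n = suc n} P f with P (f fzero)
... | true  = cong suc (countᵇ-tabulate P (f ∘ fsuc))
... | false = countᵇ-tabulate P (f ∘ fsuc)

countᵇ-none : (P : A → Bool) (f : Fin n → A) → (∀ i → P (f i) ≡ false) → countᵇ P (tabulate f) ≡ 0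
countᵇ-none {n = zero}  P f none = refl
countᵇ-none {n = suc n} P f none rewrite none fzero = countᵇ-none P (f ∘ fsuc) (none ∘ fsuc)

countᵇ-≤1 : (P : A → Bool) (f : Fin n → A) → (∀ i j → P (f i) ≡ true → P (f j) ≡ true → i ≡ j) →
  countᵇ P (tabulate f) ≤ 1
countᵇ-≤1 {n = zero}  P f unique = z≤n
countᵇ-≤1 {n = suc n} P f unique with P (f fzero) in P0
... | true  = s≤s (≤-reflexive (countᵇ-none P (f ∘ fsuc) P-suc))
  where
  P-suc : ∀ i → P (f (fsuc i)) ≡ false
  P-suc i with P (f (fsuc i)) in Pi
  ... | true with () ← unique fzero (fsuc i) P0 Pi
  ... | false = refl
... | false = countᵇ-≤1 P (f ∘ fsuc) (λ i j Pi Pj → fsuc-injective (unique (fsuc i) (fsuc j) Pi Pj))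

three≤∣p∣ : ∀ {p : Subset n} {x y z} → x ∈ p → y ∈ p → z ∈ p → x ≢ y → x ≢ z → y ≢ z → 3 ≤ ∣ p ∣
three≤∣p∣ {p = p} {x} {y} {z} x∈p y∈p z∈p x≢y x≢z y≢z = ≤-trans (s≤s two≤∣p-x∣) (x∈p⇒∣p-x∣<∣p∣ x∈p)
  where
  z∈p-x-y : z ∈ p - x - y
  z∈p-x-y = x∈p∧x≢y⇒x∈p-y (x∈p∧x≢y⇒x∈p-y z∈p (x≢z ∘ sym)) (y≢z ∘ sym)
  y∈p-x : y ∈ p - x
  y∈p-x = x∈p∧x≢y⇒x∈p-y y∈p (x≢y ∘ sym)
  two≤∣p-x∣ : 2 ≤ ∣ p - x ∣
  two≤∣p-x∣ = ≤-trans (s≤s (≤-trans (s≤s z≤n) (x∈p⇒∣p-x∣<∣p∣ z∈p-x-y))) (x∈p⇒∣p-x∣<∣p∣ y∈p-x)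

∈-tabulate⁺ : ∀ {f : Fin n → Bool} {x} → f x ≡ true → x ∈ tabulate f
∈-tabulate⁺ {f = f} {x} fx = lookup⇒[]= x _ (trans (lookup∘tabulate f x) fx)

∈-tabulate⁻ : ∀ {f : Fin n → Bool} {x} → x ∈ tabulate f → f x ≡ true
∈-tabulate⁻ {f = f} {x} x∈ = trans (sym (lookup∘tabulate f x)) ([]=⇒lookup x∈)

module _ (G : Graph) where

  step-extensive : ∀ r X → X ⊆ step G r X
  step-extensive r X {v} v∈X = ∈-tabulate⁺ (cong (_∨ (r ≤ᵇ nbrCount G X v)) ([]=⇒lookup v∈X))

  step-threshold : ∀ r X {v} → r ≤ nbrCount G X v → v ∈ step G r X
  step-threshold r X {v} r≤ =
    ∈-tabulate⁺ (trans (cong (lookup X v ∨_) (Equivalence.to T-≡ (≤⇒≤ᵇ r≤))) (∨-zeroʳ _))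

  step-cases : ∀ r X {v} → v ∈ step G r X → v ∈ X ⊎ r ≤ nbrCount G X v
  step-cases r X {v} v∈
    with lookup X v in Xv | ∈-tabulate⁻ {f = λ u → lookup X u ∨ (r ≤ᵇ nbrCount G X u)} v∈
  ... | true  | _  = inj₁ (lookup⇒[]= v X Xv)
  ... | false | r≤ = inj₂ (≤ᵇ⇒≤ r _ (Equivalence.from T-≡ r≤))

  AtMostOnce : (Fin (order G) → Bool) → Set
  AtMostOnce P = ∀ u w → P u ≡ true → P w ≡ true → u ≡ w

  nbrCount-mono : ∀ {X U} v → X ⊆ U → nbrCount G X v ≤ nbrCount G U v
  nbrCount-mono {X} {U} v X⊆U = countᵇ-mono _ _ (allFin _) adj∧U
    where
    adj∧U : ∀ u → (adj G v u ∧ lookup X u) ≡ true → (adj G v u ∧ lookup U u) ≡ true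
    adj∧U u e with adj G v u | lookup X u in Xu
    ... | true | true = []=⇒lookup (X⊆U (lookup⇒[]= u X Xu))

  nbrCount-≤2 : ∀ X v (P Q : Fin (order G) → Bool) → AtMostOnce P → AtMostOnce Q →
    (∀ u → (adj G v u ∧ lookup X u) ≡ true → (P u ∨ Q u) ≡ true) → nbrCount G X v ≤ 2
  nbrCount-≤2 X v P Q once-P once-Q covered =
    ≤-trans (countᵇ-mono _ _ (allFin _) covered)
    (≤-trans (countᵇ-∨ P Q (allFin _)) (+-mono-≤ (countᵇ-≤1 P _ once-P) (countᵇ-≤1 Q _ once-Q)))

  step-three : ∀ X {v x y z} → x ≢ y → x ≢ z → y ≢ z →
    adj G v x ≡ true → adj G v y ≡ true → adj G v z ≡ true → x ∈ X → y ∈ X → z ∈ X →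
    v ∈ step G 3 X
  step-three X {v} x≢y x≢z y≢z vx vy vz x∈X y∈X z∈X = step-threshold 3 X
    (subst (3 ≤_) (sym (countᵇ-tabulate P id))
      (three≤∣p∣ (infected-nbr vx x∈X) (infected-nbr vy y∈X) (infected-nbr vz z∈X) x≢y x≢z y≢z))
    where
    P : Fin (order G) → Bool
    P u = adj G v u ∧ lookup X u
    infected-nbr : ∀ {u} → adj G v u ≡ true → u ∈ X → u ∈ tabulate P
    infected-nbr {u} vu u∈X = ∈-tabulate⁺ (cong₂ _∧_ vu ([]=⇒lookup u∈X))

  Closed : ℕ → Subset (order G) → Set
  Closed r U = ∀ {v} → v ∉ U → nbrCount G U v < r

  infected-⊆ : ∀ {r A U} → A ⊆ U → Closed r U → ∀ t → infected G r A t ⊆ U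
  infected-⊆ A⊆U closed zero = A⊆U
  infected-⊆ {r} {U = U} A⊆U closed (suc t) {v} v∈ with step-cases r _ v∈ | v ∈? U
  ... | _               | yes v∈U = v∈U
  ... | inj₁ v∈At       | no  _   = infected-⊆ A⊆U closed t v∈At
  ... | inj₂ r≤nbrCount | no  v∉U =
    ⊥-elim (<⇒≱ (closed v∉U) (≤-trans r≤nbrCount (nbrCount-mono v (infected-⊆ A⊆U closed t))))

  closed-¬percolating : ∀ {r A U v} → A ⊆ U → Closed r U → v ∉ U → ¬ Percolating G r A
  closed-¬percolating {v = v} A⊆U closed v∉U percolating =
    v∉U (infected-⊆ A⊆U closed (proj₁ (percolating v)) (proj₂ (percolating v)))

∑< : ℕ → (ℕ → ℕ) → ℕ
∑< zero    f = 0
∑< (suc n) f = f 0 + ∑< n (f ∘ suc)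

syntax ∑< n (λ k → e) = ∑[ k < n ] e

∑-cong : ∀ n {f g : ℕ → ℕ} → (∀ k → k < n → f k ≡ g k) → ∑< n f ≡ ∑< n g
∑-cong zero    f≡g = refl
∑-cong (suc n) f≡g = cong₂ _+_ (f≡g 0 (s≤s z≤n)) (∑-cong n (λ k k<n → f≡g (suc k) (s≤s k<n)))

∑-last : ∀ n f → ∑< (suc n) f ≡ ∑< n f + f n
∑-last zero    f = +-comm (f 0) 0
∑-last (suc n) f = trans (cong (f 0 +_) (∑-last n (f ∘ suc))) (sym (+-assoc (f 0) _ _))

∑-+ : ∀ a b f → ∑< (a + b) f ≡ ∑< a f + ∑[ k < b ] f (a + k)
∑-+ zero    b f = refl
∑-+ (suc a) b f = trans (cong (f 0 +_) (∑-+ a b (f ∘ suc))) (sym (+-assoc (f 0) _ _))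

∑-distrib : ∀ n f g → ∑[ k < n ] (f k + g k) ≡ ∑< n f + ∑< n g
∑-distrib zero    f g = refl
∑-distrib (suc n) f g =
  trans (cong (f 0 + g 0 +_) (∑-distrib n (f ∘ suc) (g ∘ suc))) (interchange +-commutativeSemigroup (f 0) (g 0) _ _)

∑-comm : ∀ a b (g : ℕ → ℕ → ℕ) → ∑[ r < a ] ∑[ c < b ] g r c ≡ ∑[ c < b ] ∑[ r < a ] g r c
∑-comm zero    b g = sym (zeros b)
  where
  zeros : ∀ b → ∑[ c < b ] 0 ≡ 0
  zeros zero    = refl
  zeros (suc b) = zeros b
∑-comm (suc a) b g = trans (cong (∑[ c < b ] g 0 c +_) (∑-comm a b (g ∘ suc)))
  (sym (∑-distrib b (λ c → g 0 c) (λ c → ∑[ r < a ] g (suc r) c)))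

∑-rows : ∀ a b f → ∑< (a * b) f ≡ ∑[ r < a ] ∑[ c < b ] f (b * r + c)
∑-rows zero    b f = refl
∑-rows (suc a) b f = begin
  ∑< (b + a * b) f                                              ≡⟨ ∑-+ b (a * b) f ⟩
  ∑< b f + ∑[ k < a * b ] f (b + k)                             ≡⟨ cong₂ _+_ first rest ⟩
  ∑[ c < b ] f (b * 0 + c) + ∑[ r < a ] ∑[ c < b ] f (b * suc r + c) ∎
  where
  open ≡-Reasoning
  first : ∑< b f ≡ ∑[ c < b ] f (b * 0 + c)
  first = ∑-cong b (λ c _ → cong (λ i → f (i + c)) (sym (*-zeroʳ b)))
  rest : ∑[ k < a * b ] f (b + k) ≡ ∑[ r < a ] ∑[ c < b ] f (b * suc r + c)
  rest = trans (∑-rows a b (λ k → f (b + k)))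
    (∑-cong a (λ r _ → ∑-cong b (λ c _ → cong f (trans (sym (+-assoc b _ c)) (cong (_+ c) (sym (*-suc b r)))))))

lookupℕ : Vec Bool n → ℕ → Bool
lookupℕ []       _       = false
lookupℕ (x ∷ xs) zero    = x
lookupℕ (x ∷ xs) (suc k) = lookupℕ xs k

lookup≡lookupℕ : (xs : Vec Bool n) (i : Fin n) → lookup xs i ≡ lookupℕ xs (toℕ i)
lookup≡lookupℕ (x ∷ xs) fzero    = refl
lookup≡lookupℕ (x ∷ xs) (fsuc i) = lookup≡lookupℕ xs i

∣p∣≡∑ : (p : Subset n) → ∣ p ∣ ≡ ∑[ k < n ] ⟦ lookupℕ p k ⟧
∣p∣≡∑ []            = refl
∣p∣≡∑ (true  ∷ p) = cong suc (∣p∣≡∑ p)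
∣p∣≡∑ (false ∷ p) = ∣p∣≡∑ p

-- (row , column)
Cell : Set
Cell = ℕ × ℕ

adjacent : Cell → Cell → Bool
adjacent (r , c) (r' , c') =
  ((r ≡ᵇ r') ∧ ((suc c ≡ᵇ c') ∨ (suc c' ≡ᵇ c))) ∨ ((c ≡ᵇ c') ∧ ((suc r ≡ᵇ r') ∨ (suc r' ≡ᵇ r)))

data Neighbour : Cell → Cell → Set where
  right : ∀ {r c} → Neighbour (r , c) (r , suc c)
  left  : ∀ {r c} → 1 ≤ c → Neighbour (r , c) (r , pred c)
  down  : ∀ {r c} → Neighbour (r , c) (suc r , c)
  up    : ∀ {r c} → 1 ≤ r → Neighbour (r , c) (pred r , c)

adjacent⇒Neighbour : ∀ p q → adjacent p q ≡ true → Neighbour p q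
adjacent⇒Neighbour (r , c) (r' , c') p~q with Equivalence.to T-∨ (Equivalence.from T-≡ p~q)
... | inj₁ same-row with Equivalence.to T-∧ same-row
...   | r≡r' , c~c' with ≡ᵇ⇒≡ r r' r≡r' | Equivalence.to T-∨ c~c'
...     | refl | inj₁ c+1≡c' rewrite sym (≡ᵇ⇒≡ (suc c) c' c+1≡c') = right
...     | refl | inj₂ c'+1≡c rewrite sym (≡ᵇ⇒≡ (suc c') c c'+1≡c) = left (s≤s z≤n)
adjacent⇒Neighbour (r , c) (r' , c') p~q | inj₂ same-column with Equivalence.to T-∧ same-column
...   | c≡c' , r~r' with ≡ᵇ⇒≡ c c' c≡c' | Equivalence.to T-∨ r~r'
...     | refl | inj₁ r+1≡r' rewrite sym (≡ᵇ⇒≡ (suc r) r' r+1≡r') = down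
...     | refl | inj₂ r'+1≡r rewrite sym (≡ᵇ⇒≡ (suc r') r r'+1≡r) = up (s≤s z≤n)

Neighbour⇒adjacent : ∀ {p q} → Neighbour p q → adjacent p q ≡ true
Neighbour⇒adjacent {r , c} right rewrite ≡ᵇ-refl r | ≡ᵇ-refl c = refl
Neighbour⇒adjacent {r , suc c} (left _) rewrite ≡ᵇ-refl r | ≡ᵇ-refl c =
  cong (_∨ ((suc c ≡ᵇ c) ∧ ((suc r ≡ᵇ r) ∨ (suc r ≡ᵇ r)))) (∨-zeroʳ (suc (suc c) ≡ᵇ c))
Neighbour⇒adjacent {r , c} down rewrite ≡ᵇ-refl r | ≡ᵇ-refl c = ∨-zeroʳ _
Neighbour⇒adjacent {suc r , c} (up _) rewrite ≡ᵇ-refl r | ≡ᵇ-refl c =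
  trans (cong (((suc r ≡ᵇ r) ∧ ((suc c ≡ᵇ c) ∨ (suc c ≡ᵇ c))) ∨_) (∨-zeroʳ (suc (suc r) ≡ᵇ r))) (∨-zeroʳ _)

module Coordinates (n m : ℕ) where

  cell : Fin (n * m) → Cell
  cell x = toℕ (proj₁ (remQuot {n} m x)) , toℕ (proj₂ (remQuot {n} m x))

  OnGrid : Cell → Set
  OnGrid (r , c) = r < n × c < m

  cell-onGrid : ∀ x → OnGrid (cell x)
  cell-onGrid x = toℕ<n _ , toℕ<n _

  vertex : ∀ {p} → OnGrid p → Fin (n * m)
  vertex (r<n , c<m) = combine (fromℕ< r<n) (fromℕ< c<m)

  cell-vertex : ∀ {p} (g : OnGrid p) → cell (vertex g) ≡ p
  cell-vertex (r<n , c<m) =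
    trans (cong (λ (i , j) → toℕ i , toℕ j) (remQuot-combine {n} {m} (fromℕ< r<n) (fromℕ< c<m)))
          (cong₂ _,_ (toℕ-fromℕ< r<n) (toℕ-fromℕ< c<m))

  cell-injective : ∀ {x y} → cell x ≡ cell y → x ≡ y
  cell-injective {x} {y} x≡y = begin
    x                                 ≡⟨ combine-remQuot {n} m x ⟨
    uncurry combine (remQuot {n} m x) ≡⟨ cong₂ combine (toℕ-injective (cong proj₁ x≡y))
                                                       (toℕ-injective (cong proj₂ x≡y)) ⟩
    uncurry combine (remQuot {n} m y) ≡⟨ combine-remQuot {n} m y ⟩
    y                                 ∎
    where open ≡-Reasoning

  toℕ≡index : ∀ x → toℕ x ≡ m * proj₁ (cell x) + proj₂ (cell x)
  toℕ≡index x = trans (cong toℕ (sym (combine-remQuot {n} m x))) (toℕ-combine (proj₁ (remQuot {n} m x)) _)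

  -- Row-major, so for c ≥ m this reads a cell of another row: hence the OnGrid hypotheses below.
  _∋_ : Subset (n * m) → Cell → Bool
  X ∋ (r , c) = lookupℕ X (m * r + c)

  lookup≡∋cell : ∀ X x → lookup X x ≡ X ∋ cell x
  lookup≡∋cell X x = trans (lookup≡lookupℕ X x) (cong (lookupℕ X) (toℕ≡index x))

  ∋≡lookup-vertex : ∀ X {p} (g : OnGrid p) → X ∋ p ≡ lookup X (vertex g)
  ∋≡lookup-vertex X g = trans (cong (X ∋_) (sym (cell-vertex g))) (sym (lookup≡∋cell X (vertex g)))

  ∈⇒∋ : ∀ {X p} (g : OnGrid p) → vertex g ∈ X → X ∋ p ≡ true
  ∈⇒∋ {X} g v∈X = trans (∋≡lookup-vertex X g) ([]=⇒lookup v∈X)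

  ∋⇒∈ : ∀ {X p} (g : OnGrid p) → X ∋ p ≡ true → vertex g ∈ X
  ∋⇒∈ {X} g X∋p = lookup⇒[]= (vertex g) X (trans (sym (∋≡lookup-vertex X g)) X∋p)

  ∋-step-extensive : ∀ r X {p} → OnGrid p → X ∋ p ≡ true → step (Grid n m) r X ∋ p ≡ true
  ∋-step-extensive r X g X∋p = ∈⇒∋ g (step-extensive (Grid n m) r X (∋⇒∈ g X∋p))

  InfectedNeighbour : Subset (n * m) → Cell → Cell → Set
  InfectedNeighbour X p q = Neighbour p q × OnGrid q × X ∋ q ≡ true

  ∋-step-three : ∀ X {p q₁ q₂ q₃} → OnGrid p → q₁ ≢ q₂ → q₁ ≢ q₃ → q₂ ≢ q₃ →
    InfectedNeighbour X p q₁ → InfectedNeighbour X p q₂ → InfectedNeighbour X p q₃ →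
    step (Grid n m) 3 X ∋ p ≡ true
  ∋-step-three X g q₁≢q₂ q₁≢q₃ q₂≢q₃ (n₁ , g₁ , X∋q₁) (n₂ , g₂ , X∋q₂) (n₃ , g₃ , X∋q₃) =
    ∈⇒∋ g (step-three (Grid n m) X (distinct g₁ g₂ q₁≢q₂) (distinct g₁ g₃ q₁≢q₃) (distinct g₂ g₃ q₂≢q₃)
      (adjacent-vertices n₁ g₁) (adjacent-vertices n₂ g₂) (adjacent-vertices n₃ g₃)
      (∋⇒∈ g₁ X∋q₁) (∋⇒∈ g₂ X∋q₂) (∋⇒∈ g₃ X∋q₃))
    where
    distinct : ∀ {q q′} (h : OnGrid q) (h′ : OnGrid q′) → q ≢ q′ → vertex h ≢ vertex h′
    distinct h h′ q≢q′ v≡v′ = q≢q′ (trans (sym (cell-vertex h)) (trans (cong cell v≡v′) (cell-vertex h′)))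
    adjacent-vertices : ∀ {q} → Neighbour _ q → (h : OnGrid q) → adj (Grid n m) (vertex g) (vertex h) ≡ true
    adjacent-vertices nbr h =
      subst₂ (λ a b → adjacent a b ≡ true) (sym (cell-vertex g)) (sym (cell-vertex h)) (Neighbour⇒adjacent nbr)

  column : Subset (n * m) → ℕ → ℕ
  column X c = ∑[ r < n ] ⟦ X ∋ (r , c) ⟧

  ∣X∣≡∑column : ∀ X → ∣ X ∣ ≡ ∑[ c < m ] column X c
  ∣X∣≡∑column X = trans (∣p∣≡∑ X) (trans (∑-rows n m _) (∑-comm n m _))

_≟ᶜ_ : (p q : Cell) → Dec (p ≡ q)
_≟ᶜ_ = ≡-dec _≟_ _≟_

open import Data.List.Membership.DecPropositional _≟ᶜ_ using (lose)
  renaming (_∈_ to _∈ₗ_; _∉_ to _∉ₗ_; _∈?_ to _∈ₗ?_)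

row₀ : 0 < 3
row₀ = s≤s z≤n
row₁ : 1 < 3
row₁ = s≤s (s≤s z≤n)
row₂ : 2 < 3
row₂ = s≤s (s≤s (s≤s z≤n))

module Resistance (m : ℕ) where
  open Coordinates 3 m

  TwoExits : List Cell → Cell → Set
  TwoExits S p = ∃[ e₁ ] ∃[ e₂ ] (∀ {q} → Neighbour p q → OnGrid q → q ∉ₗ S → q ≡ e₁ ⊎ q ≡ e₂)

  Resistant : List Cell → Set
  Resistant S = ∀ {p} → p ∈ₗ S → TwoExits S p

  percolating-meets-resistant : ∀ {A S p} → Percolating (Grid 3 m) 3 A → Resistant S → p ∈ₗ S → OnGrid p →
    any (A ∋_) S ≡ true
  percolating-meets-resistant {A} {S} percolating resistant p∈S g with any (A ∋_) S in A∩S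
  ... | true  = refl
  ... | false = ⊥-elim (closed-¬percolating (Grid 3 m) A⊆U closed (λ v∈U → ∈U⇒∉S v∈U p∈S′) percolating)
    where
    U : Subset (3 * m)
    U = tabulate (λ x → not (does (cell x ∈ₗ? S)))

    ∈U⇒∉S : ∀ {x} → x ∈ U → cell x ∉ₗ S
    ∈U⇒∉S {x} x∈U x∈S with () ← trans (sym (∈-tabulate⁻ x∈U)) (cong not (dec-true (cell x ∈ₗ? S) x∈S))

    ∉S⇒∈U : ∀ {x} → cell x ∉ₗ S → x ∈ U
    ∉S⇒∈U {x} x∉S = ∈-tabulate⁺ (cong not (dec-false (cell x ∈ₗ? S) x∉S))

    p∈S′ : cell (vertex g) ∈ₗ S
    p∈S′ = subst (_∈ₗ S) (sym (cell-vertex g)) p∈S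

    A⊆U : A ⊆ U
    A⊆U {x} x∈A = ∉S⇒∈U λ x∈S → true≢false (trans (sym (Equivalence.to T-≡ (any⁺ (A ∋_)
      (lose x∈S (Equivalence.from T-≡ (trans (sym (lookup≡∋cell A x)) ([]=⇒lookup x∈A))))))) A∩S)

    closed : Closed (Grid 3 m) 3 U
    closed {v} v∉U with cell v ∈ₗ? S
    ... | no  v∉S = ⊥-elim (v∉U (∉S⇒∈U v∉S))
    ... | yes v∈S with resistant v∈S
    ...   | e₁ , e₂ , exits = s≤s (nbrCount-≤2 (Grid 3 m) U v (at e₁) (at e₂) (once e₁) (once e₂) covered)
      where
      at : Cell → Fin (3 * m) → Bool
      at e u = does (cell u ≟ᶜ e)
      at-sound : ∀ {e u} → does (cell u ≟ᶜ e) ≡ true → cell u ≡ e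
      at-sound {e} {u} eu with cell u ≟ᶜ e
      ... | yes u≡e = u≡e
      once : ∀ e → AtMostOnce (Grid 3 m) (at e)
      once e u w eu ew = cell-injective (trans (at-sound eu) (sym (at-sound ew)))
      covered : ∀ u → (adj (Grid 3 m) v u ∧ lookup U u) ≡ true → (at e₁ u ∨ at e₂ u) ≡ true
      covered u vu∧u∈U with Equivalence.to T-∧ (Equivalence.from T-≡ vu∧u∈U)
      ... | vu , u∈U with exits (adjacent⇒Neighbour _ _ (Equivalence.to T-≡ vu)) (cell-onGrid u)
                              (∈U⇒∉S (lookup⇒[]= u U (Equivalence.to T-≡ u∈U)))
      ...   | inj₁ u≡e₁ = cong (_∨ at e₂ u) (dec-true (cell u ≟ᶜ e₁) u≡e₁)
      ...   | inj₂ u≡e₂ = trans (cong (at e₁ u ∨_) (dec-true (cell u ≟ᶜ e₂) u≡e₂)) (∨-zeroʳ _)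

  off-bottom : ∀ {c} → ¬ OnGrid (3 , c)
  off-bottom (s≤s (s≤s (s≤s ())) , _)

  corner-top-left : Resistant ((0 , 0) ∷ [])
  corner-top-left (here refl) = (0 , 1) , (1 , 0) , λ where
    right    _ _ → inj₁ refl
    (left ()) _ _
    down     _ _ → inj₂ refl
    (up ())  _ _

  corner-bottom-left : Resistant ((2 , 0) ∷ [])
  corner-bottom-left (here refl) = (2 , 1) , (1 , 0) , λ where
    right    _ _ → inj₁ refl
    (left ()) _ _
    down     g _ → ⊥-elim (off-bottom g)
    (up _)   _ _ → inj₂ refl

  corner-top-right : ∀ {c} → suc c ≡ m → Resistant ((0 , c) ∷ [])
  corner-top-right {c} c+1≡m (here refl) = (0 , pred c) , (1 , c) , λ where
    right    (_ , c+1<m) _ → ⊥-elim (<-irrefl c+1≡m c+1<m)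
    (left _) _           _ → inj₁ refl
    down     _           _ → inj₂ refl
    (up ())  _           _

  corner-bottom-right : ∀ {c} → suc c ≡ m → Resistant ((2 , c) ∷ [])
  corner-bottom-right {c} c+1≡m (here refl) = (2 , pred c) , (1 , c) , λ where
    right    (_ , c+1<m) _ → ⊥-elim (<-irrefl c+1≡m c+1<m)
    (left _) _           _ → inj₁ refl
    down     g           _ → ⊥-elim (off-bottom g)
    (up _)   _           _ → inj₂ refl

  top-pair : ∀ c → Resistant ((0 , c) ∷ (0 , suc c) ∷ [])
  top-pair c (here refl) = (0 , pred c) , (1 , c) , λ where
    right    _ q∉ → ⊥-elim (q∉ (there (here refl)))
    (left _) _ _  → inj₁ refl
    down     _ _  → inj₂ refl
    (up ())  _ _
  top-pair c (there (here refl)) = (0 , suc (suc c)) , (1 , suc c) , λ where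
    right    _ _  → inj₁ refl
    (left _) _ q∉ → ⊥-elim (q∉ (here refl))
    down     _ _  → inj₂ refl
    (up ())  _ _

  bottom-pair : ∀ c → Resistant ((2 , c) ∷ (2 , suc c) ∷ [])
  bottom-pair c (here refl) = (2 , pred c) , (1 , c) , λ where
    right    _ q∉ → ⊥-elim (q∉ (there (here refl)))
    (left _) _ _  → inj₁ refl
    down     g _  → ⊥-elim (off-bottom g)
    (up _)   _ _  → inj₂ refl
  bottom-pair c (there (here refl)) = (2 , suc (suc c)) , (1 , suc c) , λ where
    right    _ _  → inj₁ refl
    (left _) _ q∉ → ⊥-elim (q∉ (here refl))
    down     g _  → ⊥-elim (off-bottom g)
    (up _)   _ _  → inj₂ refl

  full-column : ∀ c → Resistant ((0 , c) ∷ (1 , c) ∷ (2 , c) ∷ [])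
  full-column c (here refl) = (0 , pred c) , (0 , suc c) , λ where
    right    _ _  → inj₂ refl
    (left _) _ _  → inj₁ refl
    down     _ q∉ → ⊥-elim (q∉ (there (here refl)))
    (up ())  _ _
  full-column c (there (here refl)) = (1 , pred c) , (1 , suc c) , λ where
    right    _ _  → inj₂ refl
    (left _) _ _  → inj₁ refl
    down     _ q∉ → ⊥-elim (q∉ (there (there (here refl))))
    (up _)   _ q∉ → ⊥-elim (q∉ (here refl))
  full-column c (there (there (here refl))) = (2 , pred c) , (2 , suc c) , λ where
    right    _ _  → inj₂ refl
    (left _) _ _  → inj₁ refl
    down     g _  → ⊥-elim (off-bottom g)
    (up _)   _ q∉ → ⊥-elim (q∉ (there (here refl)))

  zigzag : ∀ c → Resistant ((0 , c) ∷ (1 , c) ∷ (1 , suc c) ∷ (2 , suc c) ∷ [])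
  zigzag c (here refl) = (0 , pred c) , (0 , suc c) , λ where
    right    _ _  → inj₂ refl
    (left _) _ _  → inj₁ refl
    down     _ q∉ → ⊥-elim (q∉ (there (here refl)))
    (up ())  _ _
  zigzag c (there (here refl)) = (1 , pred c) , (2 , c) , λ where
    right    _ q∉ → ⊥-elim (q∉ (there (there (here refl))))
    (left _) _ _  → inj₁ refl
    down     _ _  → inj₂ refl
    (up _)   _ q∉ → ⊥-elim (q∉ (here refl))
  zigzag c (there (there (here refl))) = (1 , suc (suc c)) , (0 , suc c) , λ where
    right    _ _  → inj₁ refl
    (left _) _ q∉ → ⊥-elim (q∉ (there (here refl)))
    down     _ q∉ → ⊥-elim (q∉ (there (there (there (here refl)))))
    (up _)   _ _  → inj₂ refl
  zigzag c (there (there (there (here refl)))) = (2 , c) , (2 , suc (suc c)) , λ where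
    right    _ _  → inj₂ refl
    (left _) _ _  → inj₁ refl
    down     g _  → ⊥-elim (off-bottom g)
    (up _)   _ q∉ → ⊥-elim (q∉ (there (there (here refl))))

  zagzig : ∀ c → Resistant ((2 , c) ∷ (1 , c) ∷ (1 , suc c) ∷ (0 , suc c) ∷ [])
  zagzig c (here refl) = (2 , pred c) , (2 , suc c) , λ where
    right    _ _  → inj₂ refl
    (left _) _ _  → inj₁ refl
    down     g _  → ⊥-elim (off-bottom g)
    (up _)   _ q∉ → ⊥-elim (q∉ (there (here refl)))
  zagzig c (there (here refl)) = (1 , pred c) , (0 , c) , λ where
    right    _ q∉ → ⊥-elim (q∉ (there (there (here refl))))
    (left _) _ _  → inj₁ refl
    down     _ q∉ → ⊥-elim (q∉ (here refl))
    (up _)   _ _  → inj₂ refl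
  zagzig c (there (there (here refl))) = (1 , suc (suc c)) , (2 , suc c) , λ where
    right    _ _  → inj₁ refl
    (left _) _ q∉ → ⊥-elim (q∉ (there (here refl)))
    down     _ _  → inj₂ refl
    (up _)   _ q∉ → ⊥-elim (q∉ (there (there (there (here refl)))))
  zagzig c (there (there (there (here refl)))) = (0 , c) , (0 , suc (suc c)) , λ where
    right    _ _  → inj₂ refl
    (left _) _ _  → inj₁ refl
    down     _ q∉ → ⊥-elim (q∉ (there (there (here refl))))
    (up ())  _ _

end-column-≥2 : ∀ (a : ℕ → Bool) → any id (a 0 ∷ []) ≡ true → any id (a 2 ∷ []) ≡ true →
  2 ≤ ∑[ r < 3 ] ⟦ a r ⟧
end-column-≥2 a h₀ h₂ with a 0 | a 1 | a 2
... | true | true  | true = s≤s (s≤s z≤n)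
... | true | false | true = s≤s (s≤s z≤n)

-- Checked by evaluating all 64 cases. By hand: if a 1 or b 1 holds, the first two hypotheses give
-- two more; otherwise the hypotheses say that any two of a 0, a 2, b 0, b 2 contain a true one.
two-columns-≥3 : ∀ (a b : ℕ → Bool) →
  any id (a 0 ∷ b 0 ∷ []) ≡ true → any id (a 2 ∷ b 2 ∷ []) ≡ true →
  any id (a 0 ∷ a 1 ∷ a 2 ∷ []) ≡ true → any id (b 0 ∷ b 1 ∷ b 2 ∷ []) ≡ true →
  any id (a 0 ∷ a 1 ∷ b 1 ∷ b 2 ∷ []) ≡ true → any id (a 2 ∷ a 1 ∷ b 1 ∷ b 0 ∷ []) ≡ true →
  3 ≤ ∑[ r < 3 ] ⟦ a r ⟧ + ∑[ r < 3 ] ⟦ b r ⟧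
two-columns-≥3 a b h₁ h₂ h₃ h₄ h₅ h₆ =
  ≤ᵇ⇒≤ 3 _ (modus-ponens (cong₂ _∧_ h₁ (cong₂ _∧_ h₂ (cong₂ _∧_ h₃ (cong₂ _∧_ h₄ (cong₂ _∧_ h₅ h₆)))))
                         (∀ᵇ-sound 6 check _ (a 0 ∷ a 1 ∷ a 2 ∷ b 0 ∷ b 1 ∷ b 2 ∷ [])))
  where
  check : Vec Bool 6 → Bool
  check (a₀ ∷ a₁ ∷ a₂ ∷ b₀ ∷ b₁ ∷ b₂ ∷ []) =
    if any id (a₀ ∷ b₀ ∷ []) ∧ any id (a₂ ∷ b₂ ∷ []) ∧
       any id (a₀ ∷ a₁ ∷ a₂ ∷ []) ∧ any id (b₀ ∷ b₁ ∷ b₂ ∷ []) ∧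
       any id (a₀ ∷ a₁ ∷ b₁ ∷ b₂ ∷ []) ∧ any id (a₂ ∷ a₁ ∷ b₁ ∷ b₀ ∷ [])
    then 3 ≤ᵇ (⟦ a₀ ⟧ + (⟦ a₁ ⟧ + (⟦ a₂ ⟧ + 0))) + (⟦ b₀ ⟧ + (⟦ b₁ ⟧ + (⟦ b₂ ⟧ + 0)))
    else true
  modus-ponens : ∀ {x y} → x ≡ true → T (if x then y else true) → T y
  modus-ponens refl t = t

-- n columns paired off from the left, each pair worth 3 and an unpaired last column worth 2
pairBound : ℕ → ℕ
pairBound zero          = 0
pairBound (suc zero)    = 2
pairBound (suc (suc n)) = 3 + pairBound n

pairBound≤∑ : ∀ n (d : ℕ → ℕ) → (∀ c → suc c < n → 3 ≤ d c + d (suc c)) → (∀ c → suc c ≡ n → 2 ≤ d c) →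
  pairBound n ≤ ∑< n d
pairBound≤∑ zero          d pairs last = z≤n
pairBound≤∑ (suc zero)    d pairs last = ≤-trans (last 0 refl) (m≤m+n (d 0) 0)
pairBound≤∑ (suc (suc n)) d pairs last = ≤-trans
  (+-mono-≤ (pairs 0 (s≤s (s≤s z≤n)))
            (pairBound≤∑ n (d ∘ suc ∘ suc) (λ c c<n → pairs (2 + c) (s≤s (s≤s c<n)))
                                          (λ c c≡n → last (2 + c) (cong (suc ∘ suc) c≡n))))
  (≤-reflexive (+-assoc (d 0) (d 1) _))

∑-1+isEven : ∀ n → ∑[ c < n ] (1 + ⟦ isEven c ⟧) ≡ pairBound n
∑-1+isEven zero          = refl
∑-1+isEven (suc zero)    = refl
∑-1+isEven (suc (suc n)) = cong (3 +_) (trans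
  (∑-cong n (λ c _ → cong (λ e → 1 + ⟦ e ⟧) (not-involutive (isEven c)))) (∑-1+isEven n))

module LowerBound (m : ℕ) {A : Subset (3 * m)} (percolating : Percolating (Grid 3 m) 3 A) where
  open Coordinates 3 m
  open Resistance m

  meets : ∀ {S p} → Resistant S → p ∈ₗ S → OnGrid p → any (A ∋_) S ≡ true
  meets = percolating-meets-resistant percolating

  first-column-≥2 : 0 < m → 2 ≤ column A 0
  first-column-≥2 0<m = end-column-≥2 (λ r → A ∋ (r , 0))
    (meets corner-top-left (here refl) (row₀ , 0<m))
    (meets corner-bottom-left (here refl) (row₂ , 0<m))

  last-column-≥2 : ∀ c → suc c ≡ m → 2 ≤ column A c
  last-column-≥2 c c+1≡m = end-column-≥2 (λ r → A ∋ (r , c))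
    (meets (corner-top-right c+1≡m) (here refl) (row₀ , c<m))
    (meets (corner-bottom-right c+1≡m) (here refl) (row₂ , c<m))
    where
    c<m : c < m
    c<m = ≤-reflexive c+1≡m

  adjacent-columns-≥3 : ∀ c → suc c < m → 3 ≤ column A c + column A (suc c)
  adjacent-columns-≥3 c c+1<m = two-columns-≥3 (λ r → A ∋ (r , c)) (λ r → A ∋ (r , suc c))
    (meets (top-pair c) (here refl) (row₀ , c<m))
    (meets (bottom-pair c) (here refl) (row₂ , c<m))
    (meets (full-column c) (here refl) (row₀ , c<m))
    (meets (full-column (suc c)) (here refl) (row₀ , c+1<m))
    (meets (zigzag c) (here refl) (row₀ , c<m))
    (meets (zagzig c) (here refl) (row₂ , c<m))
    where
    c<m : c < m
    c<m = <-trans (n<1+n c) c+1<m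

lower-bound : ∀ m {A} → Percolating (Grid 3 (suc m)) 3 A → 2 + pairBound m ≤ ∣ A ∣
lower-bound m {A} percolating = begin
  2 + pairBound m                                     ≤⟨ +-mono-≤ (first-column-≥2 (s≤s z≤n)) inner ⟩
  column A 0 + ∑[ c < m ] column A (suc c)            ≡⟨ ∣X∣≡∑column A ⟨
  ∣ A ∣                                               ∎
  where
  open Coordinates 3 (suc m)
  open LowerBound (suc m) percolating
  open ≤-Reasoning
  inner : pairBound m ≤ ∑[ c < m ] column A (suc c)
  inner = pairBound≤∑ m (column A ∘ suc) (λ c c+1<m → adjacent-columns-≥3 (suc c) (s≤s c+1<m))
                                        (λ c c+1≡m → last-column-≥2 (suc c) (cong suc c+1≡m))

outer inner : ℕ → ℕ → Bool
outer m c = isEven c ∨ (suc c ≡ᵇ m)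
inner m c = not (isEven c) ∧ (suc (suc c) ≤ᵇ m)

seed : ℕ → Cell → Bool
seed m (0 , c) = outer m c
seed m (1 , c) = inner m c
seed m (2 , c) = outer m c
seed m (suc (suc (suc _)) , _) = false

module UpperBound (k : ℕ) where
  m : ℕ
  m = 3 + k

  open Coordinates 3 m

  Seed : Subset (3 * m)
  Seed = tabulate (seed m ∘ cell)

  Seed∋ : ∀ {p} → OnGrid p → Seed ∋ p ≡ seed m p
  Seed∋ g = trans (∋≡lookup-vertex Seed g)
    (trans (lookup∘tabulate (seed m ∘ cell) (vertex g)) (cong (seed m) (cell-vertex g)))

  Step₁ Step₂ : Subset (3 * m)
  Step₁ = step (Grid 3 m) 3 Seed
  Step₂ = step (Grid 3 m) 3 Step₁

  seeded-step₁ : ∀ {p} (g : OnGrid p) → seed m p ≡ true → Step₁ ∋ p ≡ true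
  seeded-step₁ g seeded = ∋-step-extensive 3 Seed g (trans (Seed∋ g) seeded)

  outer-seeded : ∀ {t c} → OnGrid (t , c) → (∀ j → seed m (t , j) ≡ outer m j) → outer m c ≡ true →
    Seed ∋ (t , c) ≡ true
  outer-seeded {c = c} g seed-t outer≡true = trans (Seed∋ g) (trans (seed-t c) outer≡true)

  outer-step₁ : ∀ {t c} → OnGrid (t , c) → (∀ j → seed m (t , j) ≡ outer m j) → Neighbour (t , c) (1 , c) →
    Step₁ ∋ (t , c) ≡ true
  outer-step₁ {c = zero} g seed-t _ = ∋-step-extensive 3 Seed g (outer-seeded g seed-t refl)
  outer-step₁ {t} {suc c} g@(t<3 , c+1<m) seed-t vertical
    with isEven c in even-c | suc (suc c) ≡ᵇ m in last
  ... | false | _     = ∋-step-extensive 3 Seed g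
    (outer-seeded g seed-t (cong (λ e → not e ∨ (suc (suc c) ≡ᵇ m)) even-c))
  ... | true  | true  = ∋-step-extensive 3 Seed g
    (outer-seeded g seed-t (trans (cong (not (isEven c) ∨_) last) (∨-zeroʳ _)))
  ... | true  | false = ∋-step-three Seed g (λ ()) (λ ()) (λ ())
      (left (s≤s z≤n) , g-left , outer-seeded g-left seed-t (cong (_∨ (suc c ≡ᵇ m)) even-c))
      (right , g-right , outer-seeded g-right seed-t (cong (λ e → not (not e) ∨ (suc (suc (suc c)) ≡ᵇ m)) even-c))
      (vertical , g-middle , trans (Seed∋ g-middle) (cong₂ (λ e b → not (not e) ∧ b) even-c (≤ᵇ-true c+2<m)))
    where
    c+2<m : suc (suc c) < m
    c+2<m = ≤∧≢⇒< c+1<m (λ c+2≡m → true≢false (trans (sym (Equivalence.to T-≡ (≡⇒≡ᵇ _ _ c+2≡m))) last))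
    g-left : OnGrid (t , c)
    g-left = t<3 , <-trans (n<1+n c) c+1<m
    g-right : OnGrid (t , suc (suc c))
    g-right = t<3 , c+2<m
    g-middle : OnGrid (1 , suc c)
    g-middle = row₁ , c+1<m

  even-middle-step₁ : ∀ {c c′} → c < m → isEven c ≡ true → InfectedNeighbour Seed (1 , c) (1 , c′) →
    Step₁ ∋ (1 , c) ≡ true
  even-middle-step₁ {c} c<m even-c horizontal = ∋-step-three Seed (row₁ , c<m) (λ ()) (λ ()) (λ ())
    (up (s≤s z≤n) , (row₀ , c<m) , trans (Seed∋ (row₀ , c<m)) (cong (_∨ (suc c ≡ᵇ m)) even-c))
    (down         , (row₂ , c<m) , trans (Seed∋ (row₂ , c<m)) (cong (_∨ (suc c ≡ᵇ m)) even-c))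
    horizontal

  middle-step₁ : ∀ c → suc c < m → Step₁ ∋ (1 , c) ≡ true
  middle-step₁ c c+1<m with isEven c in even-c
  ... | false = seeded-step₁ (row₁ , c<m) (cong₂ (λ e b → not e ∧ b) even-c (≤ᵇ-true c+1<m))
    where
    c<m : c < m
    c<m = <-trans (n<1+n c) c+1<m
  middle-step₁ zero c+1<m | true = even-middle-step₁ (s≤s z≤n) even-c
    (right , (row₁ , c+1<m) , trans (Seed∋ (row₁ , c+1<m)) (≤ᵇ-true (m≤m+n 3 k)))
  middle-step₁ (suc c) c+2<m | true = even-middle-step₁ c+1<m even-c
    (left (s≤s z≤n) , (row₁ , c<m) , trans (Seed∋ (row₁ , c<m)) (cong₂ _∧_ even-c (≤ᵇ-true (<⇒≤ c+2<m))))
    where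
    c+1<m : suc c < m
    c+1<m = <-trans (n<1+n (suc c)) c+2<m
    c<m : c < m
    c<m = <-trans (n<1+n c) c+1<m

  last-middle-step₂ : ∀ c → suc (suc c) ≡ m → Step₂ ∋ (1 , suc c) ≡ true
  last-middle-step₂ c c+2≡m = ∋-step-three Step₁ (row₁ , c+1<m) (λ ()) (λ ()) (λ ())
    (up (s≤s z≤n) , (row₀ , c+1<m) , seeded-step₁ (row₀ , c+1<m) last-outer)
    (down         , (row₂ , c+1<m) , seeded-step₁ (row₂ , c+1<m) last-outer)
    (left (s≤s z≤n) , (row₁ , c<m) , middle-step₁ c c+1<m)
    where
    c+1<m : suc c < m
    c+1<m = ≤-reflexive c+2≡m
    c<m : c < m
    c<m = <-trans (n<1+n c) c+1<m
    last-outer : outer m (suc c) ≡ true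
    last-outer = trans (cong (not (isEven c) ∨_) (Equivalence.to T-≡ (≡⇒≡ᵇ _ _ c+2≡m))) (∨-zeroʳ _)

  Step₂-full : ∀ {p} → OnGrid p → Step₂ ∋ p ≡ true
  Step₂-full {0 , c} g = ∋-step-extensive 3 Step₁ g (outer-step₁ g (λ _ → refl) down)
  Step₂-full {2 , c} g = ∋-step-extensive 3 Step₁ g (outer-step₁ g (λ _ → refl) (up (s≤s z≤n)))
  Step₂-full {1 , c} g@(_ , c<m) with suc c <? m
  ... | yes c+1<m = ∋-step-extensive 3 Step₁ g (middle-step₁ c c+1<m)
  ... | no  c+1≮m with c | ≤∧≮⇒≡ c<m c+1≮m
  ...   | zero   | ()
  ...   | suc c′ | c+1≡m = last-middle-step₂ c′ c+1≡m
  Step₂-full {suc (suc (suc _)) , _} (s≤s (s≤s (s≤s ())) , _)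

  Seed-percolates : Percolating (Grid 3 m) 3 Seed
  Seed-percolates x = 2 , lookup⇒[]= x Step₂ (trans (lookup≡∋cell Step₂ x) (Step₂-full (cell-onGrid x)))

  column-Seed : ∀ c → c < m → column Seed c ≡ ⟦ outer m c ⟧ + (⟦ inner m c ⟧ + (⟦ outer m c ⟧ + 0))
  column-Seed c c<m = cong₂ _+_ (cong ⟦_⟧ (Seed∋ (row₀ , c<m)))
    (cong₂ _+_ (cong ⟦_⟧ (Seed∋ (row₁ , c<m))) (cong (λ b → ⟦ b ⟧ + 0) (Seed∋ (row₂ , c<m))))

  inner-column-Seed : ∀ c → suc c < m → column Seed c ≡ 1 + ⟦ isEven c ⟧
  inner-column-Seed c c+1<m rewrite column-Seed c (<-trans (n<1+n c) c+1<m)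
    | dec-false (suc c ≟ m) (<⇒≢ c+1<m) | ≤ᵇ-true c+1<m with isEven c
  ... | true  = refl
  ... | false = refl

  last-column-Seed : column Seed (2 + k) ≡ 2
  last-column-Seed rewrite column-Seed (2 + k) ≤-refl | ≡ᵇ-refl k | ≤ᵇ-false (n<1+n m) with isEven k
  ... | true  = refl
  ... | false = refl

  ∣Seed∣ : ∣ Seed ∣ ≡ 2 + pairBound (2 + k)
  ∣Seed∣ = begin
    ∣ Seed ∣                                              ≡⟨ ∣X∣≡∑column Seed ⟩
    ∑[ c < m ] column Seed c                              ≡⟨ ∑-last (2 + k) (column Seed) ⟩
    ∑[ c < 2 + k ] column Seed c + column Seed (2 + k)    ≡⟨ cong₂ _+_ inner-columns last-column-Seed ⟩
    ∑[ c < 2 + k ] (1 + ⟦ isEven c ⟧) + 2                 ≡⟨ cong (_+ 2) (∑-1+isEven (2 + k)) ⟩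
    pairBound (2 + k) + 2                                 ≡⟨ +-comm (pairBound (2 + k)) 2 ⟩
    2 + pairBound (2 + k)                                 ∎
    where
    open ≡-Reasoning
    inner-columns : ∑[ c < 2 + k ] column Seed c ≡ ∑[ c < 2 + k ] (1 + ⟦ isEven c ⟧)
    inner-columns = ∑-cong (2 + k) (λ c c<m-1 → inner-column-Seed c (s≤s c<m-1))

closedForm : ℕ → ℕ
closedForm m = if (m % 2) ≡ᵇ 1 then (3 * (m + 1)) / 2 ∸ 1 else (3 * m) / 2 + 1

closedForm-odd : ∀ m → m % 2 ≡ 1 → closedForm m ≡ 3 * (m + 1) / 2 ∸ 1
closedForm-odd m m%2≡1 = cong (λ r → if r ≡ᵇ 1 then 3 * (m + 1) / 2 ∸ 1 else 3 * m / 2 + 1) m%2≡1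

closedForm-even : ∀ m → m % 2 ≡ 0 → closedForm m ≡ 3 * m / 2 + 1
closedForm-even m m%2≡0 = cong (λ r → if r ≡ᵇ 1 then 3 * (m + 1) / 2 ∸ 1 else 3 * m / 2 + 1) m%2≡0

data Parity : ℕ → Set where
  even : ∀ k → Parity (k * 2)
  odd  : ∀ k → Parity (1 + k * 2)

parity : ∀ n → Parity n
parity zero = even 0
parity (suc n) with parity n
... | even k = odd k
... | odd  k = even (suc k)

pairBound-even : ∀ k → pairBound (k * 2) ≡ k * 3
pairBound-even zero    = refl
pairBound-even (suc k) = cong (3 +_) (pairBound-even k)

pairBound-odd : ∀ k → pairBound (1 + k * 2) ≡ k * 3 + 2
pairBound-odd zero    = refl
pairBound-odd (suc k) = cong (3 +_) (pairBound-odd k)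

triple-even : ∀ k → 3 * (1 + k * 2 + 1) ≡ (k * 3 + 3) * 2
triple-even = solve-∀

triple-odd : ∀ k → 3 * (2 + k * 2) ≡ (k * 3 + 3) * 2
triple-odd = solve-∀

closedForm-suc : ∀ n → closedForm (suc n) ≡ 2 + pairBound n
closedForm-suc n with parity n
... | even k = begin
  closedForm (1 + k * 2)                   ≡⟨ closedForm-odd (1 + k * 2) ([m+kn]%n≡m%n 1 k 2) ⟩
  3 * (1 + k * 2 + 1) / 2 ∸ 1              ≡⟨ cong (λ x → x / 2 ∸ 1) (triple-even k) ⟩
  (k * 3 + 3) * 2 / 2 ∸ 1                  ≡⟨ cong (_∸ 1) (m*n/n≡m (k * 3 + 3) 2) ⟩
  k * 3 + 3 ∸ 1                            ≡⟨ +-∸-assoc (k * 3) (s≤s z≤n) ⟩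
  k * 3 + 2                                ≡⟨ +-comm (k * 3) 2 ⟩
  2 + k * 3                                ≡⟨ cong (2 +_) (pairBound-even k) ⟨
  2 + pairBound (k * 2)                    ∎
  where open ≡-Reasoning
... | odd k = begin
  closedForm (2 + k * 2)                   ≡⟨ closedForm-even (2 + k * 2) ([m+kn]%n≡m%n 2 k 2) ⟩
  3 * (2 + k * 2) / 2 + 1                  ≡⟨ cong (λ x → x / 2 + 1) (triple-odd k) ⟩
  (k * 3 + 3) * 2 / 2 + 1                  ≡⟨ cong (_+ 1) (m*n/n≡m (k * 3 + 3) 2) ⟩
  k * 3 + 3 + 1                            ≡⟨ +-comm (k * 3 + 3) 1 ⟩
  1 + (k * 3 + 3)                          ≡⟨ cong suc (+-comm (k * 3) 3) ⟩
  4 + k * 3                                ≡⟨ cong (2 +_) (+-comm 2 (k * 3)) ⟩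
  2 + (k * 3 + 2)                          ≡⟨ cong (2 +_) (pairBound-odd k) ⟨
  2 + pairBound (1 + k * 2)                ∎
  where open ≡-Reasoning

theorem1 : ∀ (m : ℕ) → 3 ≤ m →
    IsPercolationNumber (Grid 3 m) 3
      (if (m % 2) ≡ᵇ 1 then (3 * (m + 1)) / 2 ∸ 1 else (3 * m) / 2 + 1)
theorem1 (suc (suc (suc k))) (s≤s (s≤s (s≤s _))) =
  subst (IsPercolationNumber (Grid 3 (3 + k)) 3) (sym (closedForm-suc (2 + k))) bounds
  where
  open UpperBound k
  bounds : IsPercolationNumber (Grid 3 (3 + k)) 3 (2 + pairBound (2 + k))
  bounds = (Seed , Seed-percolates , ∣Seed∣) , λ A percolating → lower-bound (2 + k) {A} percolating
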